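{- For every theorem $\sigma$ of $\mathrm{PEL}_0$ there is a derivation of $\sigma$ in $\mathrm{PEL}_0$ such that every implication subformula of every sequent occurring in that derivation is significant for that derivation.
   Context: Formulas are built from propositional variables and constants $\top,\bot$ using $\land$ and $\to$; a sequent is $\Gamma\vdash\phi$ with $\Gamma$ a finite list of formulas. $\mathrm{PL}$ has the rules: $\vdash\top$; $\phi\vdash\phi$; from $\Gamma\vdash\psi$ infer $\Gamma,\phi\vdash\psi$; from $\Gamma\vdash\phi$ and $\Gamma,\phi\vdash\psi$ infer $\Gamma\vdash\psi$; from $\Gamma\vdash\phi\land\psi$ infer $\Gamma\vdash\phi$ and $\Gamma\vdash\psi$; from $\Gamma\vdash\phi$ and $\Gamma\vdash\psi$ infer $\Gamma\vdash\phi\land\psi$; from $\Gamma\vdash\phi$ and $\Gamma\vdash\phi\to\psi$ infer $\Gamma\vdash\psi$; from $\Gamma\vdash\psi$ infer $\Gamma\vdash\phi\to\psi$. $\mathrm{PEL}_0$ is $\mathrm{PL}$ plus the rule (E$_0$): from $\phi_1\vdash\phi_2$, $\phi_2\vdash\phi_1$, $\psi_1\vdash\psi_2$ and $\psi_2\vdash\psi_1$ infer $(\phi_1\to\psi_1)\vdash(\phi_2\to\psi_2)$. A derivation is a finite sequence of sequents each obtained from earlier ones by a rule. An implication subformula is a subformula of the form $\alpha\to\beta$. For a derivation of $\sigma$, the set of significant implications is the smallest set $S$ of formulas such that: $S$ contains all implication subformulas of $\sigma$; for each application of E$_0$ in the derivation, with conclusion $(\phi_1\to\psi_1)\vdash(\phi_2\to\psi_2)$,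 either both $\phi_1\to\psi_1$ and $\phi_2\to\psi_2$ belong to $S$ or neither does; and $S$ contains all implication subformulas of its elements. -}

module Defs where

open import Data.Nat using (ℕ)
open import Data.List using (List; []; _∷_; [_]; _∷ʳ_)
open import Data.List.Membership.Propositional using (_∈_)
open import Data.List.Relation.Unary.All using (All)
open import Data.List.Relation.Unary.Any using (Any)
open import Data.Product using (_×_; ∃; _,_)
open import Data.Sum using (_⊎_)
open import Relation.Binary.PropositionalEquality using (_≡_)

infixr 6 _∧_
infixr 5 _⇒_
infix  4 _⊢_ _⊑_

data Fm : Set where
  var : ℕ → Fm
  ⊤ ⊥ : Fm
  _∧_ _⇒_ : Fm → Fm → Fm

-- Sequents Γ ⊢ φ, Γ a finite list; "Γ , φ" is Γ with φ appended at the end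
record Seq : Set where
  constructor _⊢_
  field
    ctx  : List Fm
    goal : Fm
open Seq public

data Rule : List Seq → Seq → Set where
  ⊤I    : Rule [] ([] ⊢ ⊤)
  ax    : ∀ φ → Rule [] ([ φ ] ⊢ φ)
  wk    : ∀ Γ φ ψ → Rule [ Γ ⊢ ψ ] (Γ ∷ʳ φ ⊢ ψ)
  cut   : ∀ Γ φ ψ → Rule ((Γ ⊢ φ) ∷ (Γ ∷ʳ φ ⊢ ψ) ∷ []) (Γ ⊢ ψ)
  ∧E₁   : ∀ Γ φ ψ → Rule [ Γ ⊢ φ ∧ ψ ] (Γ ⊢ φ)
  ∧E₂   : ∀ Γ φ ψ → Rule [ Γ ⊢ φ ∧ ψ ] (Γ ⊢ ψ)
  ∧I    : ∀ Γ φ ψ → Rule ((Γ ⊢ φ) ∷ (Γ ⊢ ψ) ∷ []) (Γ ⊢ φ ∧ ψ)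
  ⇒E    : ∀ Γ φ ψ → Rule ((Γ ⊢ φ) ∷ (Γ ⊢ φ ⇒ ψ) ∷ []) (Γ ⊢ ψ)
  ⇒I    : ∀ Γ φ ψ → Rule [ Γ ⊢ ψ ] (Γ ⊢ φ ⇒ ψ)
  E₀    : ∀ φ₁ φ₂ ψ₁ ψ₂ →
          Rule (([ φ₁ ] ⊢ φ₂) ∷ ([ φ₂ ] ⊢ φ₁) ∷ ([ ψ₁ ] ⊢ ψ₂) ∷ ([ ψ₂ ] ⊢ ψ₁) ∷ [])
               ([ φ₁ ⇒ ψ₁ ] ⊢ (φ₂ ⇒ ψ₂))

-- A derivation, stored newest-first: Deriv ss means ss (reversed) is a
-- finite sequence of sequents, each obtained by a rule from earlier ones.
data Deriv : List Seq → Set where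
  []   : Deriv []
  step : ∀ {ss ps s} → Deriv ss → Rule ps s → All (_∈ ss) ps → Deriv (s ∷ ss)

DerivOf : Seq → Set
DerivOf σ = ∃ λ ss → Deriv (σ ∷ ss)

Theorem : Seq → Set
Theorem σ = DerivOf σ

data E₀App : {ss : List Seq} → Deriv ss → Fm → Fm → Set where
  here  : ∀ {ss} {d : Deriv ss} {φ₁ φ₂ ψ₁ ψ₂} {as} →
          E₀App (step d (E₀ φ₁ φ₂ ψ₁ ψ₂) as) (φ₁ ⇒ ψ₁) (φ₂ ⇒ ψ₂)
  there : ∀ {ss ps s} {d : Deriv ss} {r : Rule ps s} {as} {α β} →
          E₀App d α β → E₀App (step d r as) α β

data _⊑_ : Fm → Fm → Set where
  refl : ∀ {φ} → φ ⊑ φ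
  ∧ₗ   : ∀ {χ φ ψ} → χ ⊑ φ → χ ⊑ φ ∧ ψ
  ∧ᵣ   : ∀ {χ φ ψ} → χ ⊑ ψ → χ ⊑ φ ∧ ψ
  ⇒ₗ   : ∀ {χ φ ψ} → χ ⊑ φ → χ ⊑ φ ⇒ ψ
  ⇒ᵣ   : ∀ {χ φ ψ} → χ ⊑ ψ → χ ⊑ φ ⇒ ψ

ImpSub : Fm → Fm → Set
ImpSub χ φ = (∃ λ α → ∃ λ β → χ ≡ (α ⇒ β)) × χ ⊑ φ

ImpSubSeq : Fm → Seq → Set
ImpSubSeq χ s = Any (ImpSub χ) (ctx s) ⊎ ImpSub χ (goal s)

-- Significant implications of a derivation d of σ: the smallest set S with
-- the closure properties (given as an inductive definition).
data Significant (σ : Seq) {ss} (d : Deriv ss) : Fm → Set where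
  base : ∀ {χ} → ImpSubSeq χ σ → Significant σ d χ
  e₀→  : ∀ {α β} → E₀App d α β → Significant σ d α → Significant σ d β
  e₀←  : ∀ {α β} → E₀App d α β → Significant σ d β → Significant σ d α
  sub  : ∀ {χ φ} → Significant σ d φ → ImpSub χ φ → Significant σ d χ

-- Fix a derivation of σ and let S be its set of significant implications. Saturating the
-- implication subformulas of σ along the finitely many E₀ applications shows that S is decidable.
-- Now erase every implication α ⇒ β ∉ S to β throughout the derivation. Each rule instance becomes
-- an instance of the same rule, except ⇒I and ⇒E on an erased implication and E₀ between erased
-- ones, whose conclusions coincide with the erasure of a premise; E₀ between a kept and an erased
-- implication cannot occur, as S is closed under E₀ in both directions. The erasure fixes σ, all
-- implications of the new derivation lie in S, and every E₀ application inside S survives, so S is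
-- still significant for the new derivation.

module Submission where

open import Defs
open import Data.Empty using (⊥-elim)
open import Data.List using (List; []; _∷_; [_]; _++_; map; length; filter)
open import Data.List.Membership.Propositional using (_∈_; find; lose)
open import Data.List.Membership.Propositional.Properties
  using (∈-filter⁺; ∈-filter⁻; ∈-++⁺ʳ; ∈-++⁻)
open import Data.List.Properties using (map-++; map-id-local; filter-notAll)
open import Data.List.Relation.Binary.Subset.Propositional using () renaming (_⊆_ to _⊆ˡ_)
open import Data.List.Relation.Binary.Subset.Propositional.Properties using (map⁺; ⊆-refl)
open import Data.List.Relation.Unary.All as All using (All; []; _∷_)
open import Data.List.Relation.Unary.Any as Any using (Any; here; there; any?)
open import Data.List.Relation.Unary.Any.Properties using (map⁻)
import Data.Nat as ℕ
open import Data.Nat using (_<_)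
open import Data.Nat.Induction using (<-wellFounded)
open import Data.Product using (∃; _×_; _,_; proj₁; proj₂; map₂)
open import Data.Sum using (_⊎_; inj₁; inj₂; [_,_]′)
open import Function using (_∘_)
open import Function.Bundles using (_⇔_; mk⇔; Equivalence)
open import Induction.WellFounded using (Acc; acc)
open import Relation.Binary.Definitions using (DecidableEquality)
open import Relation.Binary.PropositionalEquality
  using (_≡_; refl; sym; trans; cong; cong₂; subst; subst₂)
open import Relation.Nullary using (Dec; yes; no; ¬_; ¬?; _×-dec_; _⊎-dec_)
open import Relation.Nullary.Decidable using (map′)
open import Relation.Unary using (_⊆_; Decidable)

_≟_ : DecidableEquality Fm
var m ≟ var n = map′ (cong var) (λ { refl → refl }) (m ℕ.≟ n)
⊤ ≟ ⊤ = yes refl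
⊥ ≟ ⊥ = yes refl
(a ∧ b) ≟ (c ∧ d) = map′ (λ { (refl , refl) → refl }) (λ { refl → refl , refl }) (a ≟ c ×-dec b ≟ d)
(a ⇒ b) ≟ (c ⇒ d) = map′ (λ { (refl , refl) → refl }) (λ { refl → refl , refl }) (a ≟ c ×-dec b ≟ d)
var _ ≟ ⊤ = no λ ()
var _ ≟ ⊥ = no λ ()
var _ ≟ (_ ∧ _) = no λ ()
var _ ≟ (_ ⇒ _) = no λ ()
⊤ ≟ var _ = no λ ()
⊤ ≟ ⊥ = no λ ()
⊤ ≟ (_ ∧ _) = no λ ()
⊤ ≟ (_ ⇒ _) = no λ ()
⊥ ≟ var _ = no λ ()
⊥ ≟ ⊤ = no λ ()
⊥ ≟ (_ ∧ _) = no λ ()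
⊥ ≟ (_ ⇒ _) = no λ ()
(_ ∧ _) ≟ var _ = no λ ()
(_ ∧ _) ≟ ⊤ = no λ ()
(_ ∧ _) ≟ ⊥ = no λ ()
(_ ∧ _) ≟ (_ ⇒ _) = no λ ()
(_ ⇒ _) ≟ var _ = no λ ()
(_ ⇒ _) ≟ ⊤ = no λ ()
(_ ⇒ _) ≟ ⊥ = no λ ()
(_ ⇒ _) ≟ (_ ∧ _) = no λ ()

_⊑?_ : ∀ χ φ → Dec (χ ⊑ φ)
χ ⊑? φ with χ ≟ φ
... | yes refl = yes refl
χ ⊑? var n   | no χ≢φ = no λ { refl → χ≢φ refl }
χ ⊑? ⊤       | no χ≢φ = no λ { refl → χ≢φ refl }
χ ⊑? ⊥       | no χ≢φ = no λ { refl → χ≢φ refl }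
χ ⊑? (a ∧ b) | no χ≢φ = map′ [ ∧ₗ , ∧ᵣ ]′
  (λ { refl → ⊥-elim (χ≢φ refl) ; (∧ₗ p) → inj₁ p ; (∧ᵣ p) → inj₂ p }) (χ ⊑? a ⊎-dec χ ⊑? b)
χ ⊑? (a ⇒ b) | no χ≢φ = map′ [ ⇒ₗ , ⇒ᵣ ]′
  (λ { refl → ⊥-elim (χ≢φ refl) ; (⇒ₗ p) → inj₁ p ; (⇒ᵣ p) → inj₂ p }) (χ ⊑? a ⊎-dec χ ⊑? b)

⊑-trans : ∀ {χ φ ψ} → χ ⊑ φ → φ ⊑ ψ → χ ⊑ ψ
⊑-trans p refl   = p
⊑-trans p (∧ₗ q) = ∧ₗ (⊑-trans p q)
⊑-trans p (∧ᵣ q) = ∧ᵣ (⊑-trans p q)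
⊑-trans p (⇒ₗ q) = ⇒ₗ (⊑-trans p q)
⊑-trans p (⇒ᵣ q) = ⇒ᵣ (⊑-trans p q)

IsImp : Fm → Set
IsImp χ = ∃ λ α → ∃ λ β → χ ≡ (α ⇒ β)

isImp? : ∀ χ → Dec (IsImp χ)
isImp? (var _) = no λ ()
isImp? ⊤       = no λ ()
isImp? ⊥       = no λ ()
isImp? (_ ∧ _) = no λ ()
isImp? (a ⇒ b) = yes (a , b , refl)

ImpSub? : ∀ χ φ → Dec (ImpSub χ φ)
ImpSub? χ φ = isImp? χ ×-dec χ ⊑? φ

ImpSub-refl : ∀ {χ} → IsImp χ → ImpSub χ χ
ImpSub-refl i = i , refl

ImpSub-trans : ∀ {χ φ ψ} → ImpSub χ φ → ImpSub φ ψ → ImpSub χ ψ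
ImpSub-trans (i , p) (_ , q) = i , ⊑-trans p q

ImpClosure : List Fm → (Fm → Set)
ImpClosure L χ = Any (ImpSub χ) L

ImpClosure-sub : ∀ {L φ χ} → ImpClosure L φ → ImpSub χ φ → ImpClosure L χ
ImpClosure-sub a i = Any.map (ImpSub-trans i) a

ImpsWithin : (Fm → Set) → Fm → Set
ImpsWithin T φ = ∀ χ → ImpSub χ φ → T χ

ImpsWithinSeq : (Fm → Set) → (Seq → Set)
ImpsWithinSeq T s = ∀ χ → ImpSubSeq χ s → T χ

Balanced : (Fm → Set) → List (Fm × Fm) → Set
Balanced T P = ∀ {α β} → (α , β) ∈ P → T α ⇔ T β

data E₀Instance : ∀ {ps s} → Rule ps s → Fm → Fm → Set where
  E₀ᵢ : ∀ {φ₁ φ₂ ψ₁ ψ₂} → E₀Instance (E₀ φ₁ φ₂ ψ₁ ψ₂) (φ₁ ⇒ ψ₁) (φ₂ ⇒ ψ₂)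

E₀App-step⁻ : ∀ {ss ps s} {d : Deriv ss} {r : Rule ps s} {as α β} →
              E₀App (step d r as) α β → E₀Instance r α β ⊎ E₀App d α β
E₀App-step⁻ here      = inj₁ E₀ᵢ
E₀App-step⁻ (there e) = inj₂ e

E₀App-here : ∀ {ss ps s} {d : Deriv ss} {r : Rule ps s} {as α β} →
             E₀Instance r α β → E₀App (step d r as) α β
E₀App-here E₀ᵢ = here

E₀App-imps : ∀ {ss} {d : Deriv ss} {α β} → E₀App d α β → IsImp α × IsImp β
E₀App-imps here      = (_ , _ , refl) , (_ , _ , refl)
E₀App-imps (there e) = E₀App-imps e

rule-pairs : ∀ {ps s} → Rule ps s → List (Fm × Fm)
rule-pairs (E₀ φ₁ φ₂ ψ₁ ψ₂) = [ φ₁ ⇒ ψ₁ , φ₂ ⇒ ψ₂ ]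
rule-pairs _                = []

E₀-pairs : ∀ {ss} → Deriv ss → List (Fm × Fm)
E₀-pairs []           = []
E₀-pairs (step d r _) = rule-pairs r ++ E₀-pairs d

E₀App⇒∈E₀-pairs : ∀ {ss} {d : Deriv ss} {α β} → E₀App d α β → (α , β) ∈ E₀-pairs d
E₀App⇒∈E₀-pairs here              = here refl
E₀App⇒∈E₀-pairs (there {r = r} e) = ∈-++⁺ʳ (rule-pairs r) (E₀App⇒∈E₀-pairs e)

∈E₀-pairs⇒E₀App : ∀ {ss} (d : Deriv ss) {α β} → (α , β) ∈ E₀-pairs d → E₀App d α β
∈E₀-pairs⇒E₀App (step d r _) m with ∈-++⁻ (rule-pairs r) m
∈E₀-pairs⇒E₀App (step d (E₀ _ _ _ _) _) _ | inj₁ (here refl) = here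
∈E₀-pairs⇒E₀App (step d r _)            _ | inj₂ m           = there (∈E₀-pairs⇒E₀App d m)

Significant-mono : ∀ {σ ss ss′} {d : Deriv ss} {d′ : Deriv ss′} →
  (∀ {α β} → E₀App d α β → Significant σ d α → Significant σ d β → E₀App d′ α β) →
  ∀ {χ} → Significant σ d χ → Significant σ d′ χ
Significant-mono keep (base i)  = base i
Significant-mono keep (e₀→ e s) = e₀→ (keep e s (e₀→ e s)) (Significant-mono keep s)
Significant-mono keep (e₀← e s) = e₀← (keep e (e₀← e s) s) (Significant-mono keep s)
Significant-mono keep (sub s i) = sub (Significant-mono keep s) i

rederive : ∀ {ss s} → Deriv ss → s ∈ ss → Deriv (s ∷ (ctx s ⊢ goal s ∧ goal s) ∷ ss)
rederive {s = Γ ⊢ φ} d m = step (step d (∧I Γ φ φ) (m ∷ m ∷ [])) (∧E₁ Γ φ φ) (here refl ∷ [])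

ImpsWithinSeq-∧-dup : ∀ {T Γ φ} → ImpsWithinSeq T (Γ ⊢ φ) → ImpsWithinSeq T (Γ ⊢ φ ∧ φ)
ImpsWithinSeq-∧-dup w χ (inj₁ a)                     = w χ (inj₁ a)
ImpsWithinSeq-∧-dup w χ (inj₂ (i , ∧ₗ p))            = w χ (inj₂ (i , p))
ImpsWithinSeq-∧-dup w χ (inj₂ (i , ∧ᵣ p))            = w χ (inj₂ (i , p))
ImpsWithinSeq-∧-dup w χ (inj₂ ((_ , _ , ()) , refl))

ImpClosure? : ∀ L → Decidable (ImpClosure L)
ImpClosure? L χ = any? (ImpSub? χ) L

-- Minimality of the saturation is expressed as inclusion in every S with these closure properties.
module Saturation
  (P : List (Fm × Fm)) (P-imps : ∀ {α β} → (α , β) ∈ P → IsImp α × IsImp β)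
  (S : Fm → Set) (S-sub : ∀ {φ χ} → S φ → ImpSub χ φ → S χ) (S-balanced : Balanced S P)
  (L₀ : List Fm) (L₀-⊆S : ImpClosure L₀ ⊆ S)
  where

  Both : List Fm → Fm × Fm → Set
  Both L (α , β) = ImpClosure L α × ImpClosure L β

  Both? : ∀ L → Decidable (Both L)
  Both? L (α , β) = ImpClosure? L α ×-dec ImpClosure? L β

  Touched : List Fm → Fm × Fm → Set
  Touched L (α , β) = ImpClosure L α ⊎ ImpClosure L β

  Touched? : ∀ L → Decidable (Touched L)
  Touched? L (α , β) = ImpClosure? L α ⊎-dec ImpClosure? L β

  record Stage : Set where
    field
      roots      : List Fm
      pending    : List (Fm × Fm)
      roots-⊇L₀  : ImpClosure L₀ ⊆ ImpClosure roots
      roots-⊆S   : ImpClosure roots ⊆ S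
      pending-⊆P : pending ⊆ˡ P
      settled    : ∀ {p} → p ∈ P → Both roots p ⊎ p ∈ pending

  record Saturated : Set where
    field
      roots          : List Fm
      roots-⊇L₀      : ImpClosure L₀ ⊆ ImpClosure roots
      roots-⊆S       : ImpClosure roots ⊆ S
      roots-balanced : Balanced (ImpClosure roots) P

  module _ (st : Stage) where
    open Stage st

    saturated-if-untouched : (∀ {p} → p ∈ pending → ¬ Touched roots p) → Saturated
    saturated-if-untouched untouched = record
      { roots = roots ; roots-⊇L₀ = roots-⊇L₀ ; roots-⊆S = roots-⊆S ; roots-balanced = balanced }
      where
      balanced : Balanced (ImpClosure roots) P
      balanced m with settled m
      ... | inj₁ (a , b) = mk⇔ (λ _ → b) (λ _ → a)
      ... | inj₂ m′      = mk⇔ (⊥-elim ∘ untouched m′ ∘ inj₁) (⊥-elim ∘ untouched m′ ∘ inj₂)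

    add : ∀ {α β} → (α , β) ∈ pending → Touched roots (α , β) → Stage
    add {α} {β} m touched = record
      { roots      = roots′
      ; pending    = filter (¬? ∘ Both? roots′) pending
      ; roots-⊇L₀  = λ a → there (there (roots-⊇L₀ a))
      ; roots-⊆S   = roots-⊆S′
      ; pending-⊆P = λ m′ → pending-⊆P (proj₁ (∈-filter⁻ (¬? ∘ Both? roots′) m′))
      ; settled    = settled′
      }
      where
      roots′ : List Fm
      roots′ = α ∷ β ∷ roots
      S-α : S α
      S-α = [ roots-⊆S , Equivalence.from (S-balanced (pending-⊆P m)) ∘ roots-⊆S ]′ touched
      S-β : S β
      S-β = Equivalence.to (S-balanced (pending-⊆P m)) S-α
      roots-⊆S′ : ImpClosure roots′ ⊆ S
      roots-⊆S′ (here i)          = S-sub S-α i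
      roots-⊆S′ (there (here i))  = S-sub S-β i
      roots-⊆S′ (there (there a)) = roots-⊆S a
      settled′ : ∀ {p} → p ∈ P → Both roots′ p ⊎ p ∈ filter (¬? ∘ Both? roots′) pending
      settled′ m′ with settled m′ | Both? roots′ _
      ... | inj₁ (a , b) | _        = inj₁ (there (there a) , there (there b))
      ... | inj₂ _       | yes both = inj₁ both
      ... | inj₂ m″      | no ¬both = inj₂ (∈-filter⁺ (¬? ∘ Both? roots′) m″ ¬both)

  open Stage

  add-shrinks : ∀ st {α β} (m : (α , β) ∈ pending st) (t : Touched (roots st) (α , β)) →
                length (pending (add st m t)) < length (pending st)
  add-shrinks st {α} {β} m t =
    filter-notAll (¬? ∘ Both? (α ∷ β ∷ roots st)) (pending st) (lose m λ ¬both → ¬both both)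
    where
    imps : IsImp α × IsImp β
    imps = P-imps (pending-⊆P st m)
    both : Both (α ∷ β ∷ roots st) (α , β)
    both = here (ImpSub-refl (proj₁ imps)) , there (here (ImpSub-refl (proj₂ imps)))

  saturate-from : ∀ st → Acc _<_ (length (pending st)) → Saturated
  saturate-from st (acc rec) with any? (Touched? (roots st)) (pending st)
  ... | no ¬touched = saturated-if-untouched st λ m t → ¬touched (lose m t)
  ... | yes touched with find touched
  ...   | _ , m , t = saturate-from (add st m t) (rec (add-shrinks st m t))

  saturate : Saturated
  saturate = saturate-from initial (<-wellFounded _)
    where
    initial : Stage
    initial = record
      { roots = L₀ ; pending = P ; roots-⊇L₀ = λ a → a ; roots-⊆S = L₀-⊆S
      ; pending-⊆P = λ m → m ; settled = inj₂ }

significant? : ∀ σ {ss} (d : Deriv ss) → Decidable (Significant σ d)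
significant? σ d χ = map′ roots-⊆S closure-complete (ImpClosure? roots χ)
  where
  σ-roots : ImpClosure (goal σ ∷ ctx σ) ⊆ Significant σ d
  σ-roots (here i)  = base (inj₂ i)
  σ-roots (there a) = base (inj₁ a)
  E₀-balanced : Balanced (Significant σ d) (E₀-pairs d)
  E₀-balanced m = let e = ∈E₀-pairs⇒E₀App d m in mk⇔ (e₀→ e) (e₀← e)
  open Saturation (E₀-pairs d) (E₀App-imps ∘ ∈E₀-pairs⇒E₀App d) (Significant σ d) sub
    E₀-balanced (goal σ ∷ ctx σ) σ-roots
  open Saturated saturate
  closure-complete : Significant σ d ⊆ ImpClosure roots
  closure-complete (base (inj₁ a)) = roots-⊇L₀ (there a)
  closure-complete (base (inj₂ i)) = roots-⊇L₀ (here i)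
  closure-complete (e₀→ e s)       =
    Equivalence.to (roots-balanced (E₀App⇒∈E₀-pairs e)) (closure-complete s)
  closure-complete (e₀← e s)       =
    Equivalence.from (roots-balanced (E₀App⇒∈E₀-pairs e)) (closure-complete s)
  closure-complete (sub s i)       = ImpClosure-sub (closure-complete s) i

module Erasure (T : Fm → Set) (T? : Decidable T) (T-sub : ∀ {φ χ} → T φ → ImpSub χ φ → T χ) where

  erase : Fm → Fm
  erase (var n) = var n
  erase ⊤       = ⊤
  erase ⊥       = ⊥
  erase (a ∧ b) = erase a ∧ erase b
  erase (a ⇒ b) with T? (a ⇒ b)
  ... | yes _ = erase a ⇒ erase b
  ... | no _  = erase b

  erase-⇒-kept : ∀ {a b} → T (a ⇒ b) → erase (a ⇒ b) ≡ erase a ⇒ erase b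
  erase-⇒-kept {a} {b} p with T? (a ⇒ b)
  ... | yes _ = refl
  ... | no ¬p = ⊥-elim (¬p p)

  erase-⇒-dropped : ∀ {a b} → ¬ T (a ⇒ b) → erase (a ⇒ b) ≡ erase b
  erase-⇒-dropped {a} {b} ¬p with T? (a ⇒ b)
  ... | yes p = ⊥-elim (¬p p)
  ... | no _  = refl

  erase-id : ∀ φ → ImpsWithin T φ → erase φ ≡ φ
  erase-id (var n) w = refl
  erase-id ⊤       w = refl
  erase-id ⊥       w = refl
  erase-id (a ∧ b) w = cong₂ _∧_ (erase-id a λ χ → w χ ∘ map₂ ∧ₗ) (erase-id b λ χ → w χ ∘ map₂ ∧ᵣ)
  erase-id (a ⇒ b) w = trans (erase-⇒-kept (w _ (ImpSub-refl (a , b , refl))))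
    (cong₂ _⇒_ (erase-id a λ χ → w χ ∘ map₂ ⇒ₗ) (erase-id b λ χ → w χ ∘ map₂ ⇒ᵣ))

  erase-⇒-id : ∀ {a b} → T (a ⇒ b) → erase a ⇒ erase b ≡ a ⇒ b
  erase-⇒-id p = trans (sym (erase-⇒-kept p)) (erase-id _ λ χ → T-sub p)

  erase-imps : ∀ φ → ImpsWithin T (erase φ)
  erase-imps (var n) χ ((_ , _ , ()) , refl)
  erase-imps ⊤       χ ((_ , _ , ()) , refl)
  erase-imps ⊥       χ ((_ , _ , ()) , refl)
  erase-imps (a ∧ b) χ ((_ , _ , ()) , refl)
  erase-imps (a ∧ b) χ (i , ∧ₗ s) = erase-imps a χ (i , s)
  erase-imps (a ∧ b) χ (i , ∧ᵣ s) = erase-imps b χ (i , s)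
  erase-imps (a ⇒ b) χ (i , s) with T? (a ⇒ b)
  erase-imps (a ⇒ b) χ (i , refl) | yes p = subst T (sym (erase-⇒-id p)) p
  erase-imps (a ⇒ b) χ (i , ⇒ₗ s) | yes p = erase-imps a χ (i , s)
  erase-imps (a ⇒ b) χ (i , ⇒ᵣ s) | yes p = erase-imps b χ (i , s)
  erase-imps (a ⇒ b) χ (i , s)    | no _  = erase-imps b χ (i , s)

  eraseSeq : Seq → Seq
  eraseSeq (Γ ⊢ φ) = map erase Γ ⊢ erase φ

  eraseSeq-id : ∀ {s} → ImpsWithinSeq T s → eraseSeq s ≡ s
  eraseSeq-id {Γ ⊢ φ} w = cong₂ _⊢_
    (map-id-local (All.tabulate λ m → erase-id _ λ χ → w χ ∘ inj₁ ∘ lose m))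
    (erase-id φ λ χ → w χ ∘ inj₂)

  eraseSeq-imps : ∀ s → ImpsWithinSeq T (eraseSeq s)
  eraseSeq-imps (Γ ⊢ φ) χ (inj₁ a) with find (map⁻ a)
  ... | ψ , _ , i = erase-imps ψ χ i
  eraseSeq-imps (Γ ⊢ φ) χ (inj₂ i) = erase-imps φ χ i

  data RuleErasure {ps s} (r : Rule ps s) : Set where
    kept    : ∀ {ps′ s′} (r′ : Rule ps′ s′) → eraseSeq s ≡ s′ → ps′ ⊆ˡ map eraseSeq ps →
              (∀ {α β} → E₀Instance r α β → T α → T β → E₀Instance r′ α β) → RuleErasure r
    dropped : eraseSeq s ∈ map eraseSeq ps → (∀ {α β} → E₀Instance r α β → ¬ T α) → RuleErasure r

  erase-rule : ∀ {ps s} (r : Rule ps s) → (∀ {α β} → E₀Instance r α β → T α ⇔ T β) → RuleErasure r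
  erase-rule ⊤I           _ = kept ⊤I refl ⊆-refl λ ()
  erase-rule (ax φ)       _ = kept (ax (erase φ)) refl ⊆-refl λ ()
  erase-rule (wk Γ φ ψ)   _ = kept (wk (map erase Γ) (erase φ) (erase ψ))
    (cong (_⊢ erase ψ) (map-++ erase Γ [ φ ])) ⊆-refl λ ()
  erase-rule (cut Γ φ ψ)  _ = kept (cut (map erase Γ) (erase φ) (erase ψ)) refl
    (λ { (here refl) → here refl
       ; (there (here refl)) → there (here (cong (_⊢ erase ψ) (sym (map-++ erase Γ [ φ ])))) })
    λ ()
  erase-rule (∧E₁ Γ φ ψ)  _ = kept (∧E₁ (map erase Γ) (erase φ) (erase ψ)) refl ⊆-refl λ ()
  erase-rule (∧E₂ Γ φ ψ)  _ = kept (∧E₂ (map erase Γ) (erase φ) (erase ψ)) refl ⊆-refl λ ()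
  erase-rule (∧I Γ φ ψ)   _ = kept (∧I (map erase Γ) (erase φ) (erase ψ)) refl ⊆-refl λ ()
  erase-rule (⇒E Γ φ ψ)   _ with T? (φ ⇒ ψ)
  ... | yes p = kept (⇒E (map erase Γ) (erase φ) (erase ψ)) refl
    (λ { (here refl) → here refl
       ; (there (here refl)) → there (here (cong (map erase Γ ⊢_) (sym (erase-⇒-kept p)))) })
    λ ()
  ... | no ¬p = dropped (there (here (cong (map erase Γ ⊢_) (sym (erase-⇒-dropped ¬p))))) λ ()
  erase-rule (⇒I Γ φ ψ)   _ with T? (φ ⇒ ψ)
  ... | yes p = kept (⇒I (map erase Γ) (erase φ) (erase ψ))
    (cong (map erase Γ ⊢_) (erase-⇒-kept p)) ⊆-refl λ ()
  ... | no ¬p = dropped (here (cong (map erase Γ ⊢_) (erase-⇒-dropped ¬p))) λ ()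
  erase-rule (E₀ φ₁ φ₂ ψ₁ ψ₂) balanced with T? (φ₁ ⇒ ψ₁)
  ... | yes p = kept (E₀ (erase φ₁) (erase φ₂) (erase ψ₁) (erase ψ₂))
    (cong₂ (λ a b → [ a ] ⊢ b) (erase-⇒-kept p) (erase-⇒-kept q)) ⊆-refl
    λ { E₀ᵢ _ _ → subst₂ (E₀Instance _) (erase-⇒-id p) (erase-⇒-id q) E₀ᵢ }
    where
    q : T (φ₂ ⇒ ψ₂)
    q = Equivalence.to (balanced E₀ᵢ) p
  ... | no ¬p = dropped
    (there (there (here (cong₂ (λ a b → [ a ] ⊢ b) (erase-⇒-dropped ¬p) (erase-⇒-dropped ¬q)))))
    λ { E₀ᵢ → ¬p }
    where
    ¬q : ¬ T (φ₂ ⇒ ψ₂)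
    ¬q = ¬p ∘ Equivalence.from (balanced E₀ᵢ)

  record ErasedDerivation {ss} (d : Deriv ss) : Set where
    field
      out        : List Seq
      derivation : Deriv out
      erased-⊆   : map eraseSeq ss ⊆ˡ out
      imps-in-T  : All (ImpsWithinSeq T) out
      E₀-kept    : ∀ {α β} → E₀App d α β → T α → T β → E₀App derivation α β

  erased-premises : ∀ {ss ps} {d : Deriv ss} (ed : ErasedDerivation d) →
                    All (_∈ ss) ps → map eraseSeq ps ⊆ˡ ErasedDerivation.out ed
  erased-premises ed as = ErasedDerivation.erased-⊆ ed ∘ map⁺ eraseSeq (All.lookup as)

  extend : ∀ {ss ps s} {d : Deriv ss} {r : Rule ps s} (as : All (_∈ ss) ps) →
           ErasedDerivation d → RuleErasure r → ErasedDerivation (step d r as)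
  extend {s = s} as ed (kept {s′ = s′} r′ eq ps′⊆ keep) = record
    { out        = s′ ∷ out
    ; derivation = step derivation r′ (All.tabulate (erased-premises ed as ∘ ps′⊆))
    ; erased-⊆   = λ { (here refl) → here eq ; (there m) → there (erased-⊆ m) }
    ; imps-in-T  = subst (ImpsWithinSeq T) eq (eraseSeq-imps s) ∷ imps-in-T
    ; E₀-kept    = λ e a b →
        [ (λ i → E₀App-here (keep i a b)) , (λ e′ → there (E₀-kept e′ a b)) ]′ (E₀App-step⁻ e)
    }
    where open ErasedDerivation ed
  extend {s = s} as ed (dropped m drop) = record
    { out        = _
    ; derivation = rederive derivation (erased-premises ed as m)
    ; erased-⊆   = λ { (here refl) → here refl ; (there m′) → there (there (erased-⊆ m′)) }
    ; imps-in-T  = eraseSeq-imps s ∷ ImpsWithinSeq-∧-dup (eraseSeq-imps s) ∷ imps-in-T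
    ; E₀-kept    = λ e a b →
        [ (λ i → ⊥-elim (drop i a)) , (λ e′ → there (there (E₀-kept e′ a b))) ]′ (E₀App-step⁻ e)
    }
    where open ErasedDerivation ed

  erase-deriv : ∀ {ss} (d : Deriv ss) → (∀ {α β} → E₀App d α β → T α ⇔ T β) → ErasedDerivation d
  erase-deriv [] _ = record
    { out = [] ; derivation = [] ; erased-⊆ = λ () ; imps-in-T = [] ; E₀-kept = λ () }
  erase-deriv (step d r as) balanced =
    extend as (erase-deriv d (balanced ∘ there)) (erase-rule r (balanced ∘ E₀App-here))

lemma7p1 : ∀ σ → Theorem σ →
    ∃ λ ss → ∃ λ (d : Deriv (σ ∷ ss)) →
      ∀ s → s ∈ (σ ∷ ss) → ∀ χ → ImpSubSeq χ s → Significant σ d χ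
-- The erasure ends with σ as well, but re-deriving σ spares tracking that.
lemma7p1 σ (_ , d) = _ , rederive derivation σ∈out , λ s m χ →
  Significant-mono (λ e a b → there (there (E₀-kept e a b)))
    ∘ All.lookup (σ-imps ∷ ImpsWithinSeq-∧-dup σ-imps ∷ imps-in-T) m χ
  where
  open Erasure (Significant σ d) (significant? σ d) sub
  open ErasedDerivation (erase-deriv d λ e → mk⇔ (e₀→ e) (e₀← e))
  σ-imps : ImpsWithinSeq (Significant σ d) σ
  σ-imps χ = base
  σ∈out : σ ∈ out
  σ∈out = subst (_∈ out) (eraseSeq-id σ-imps) (erased-⊆ (here refl))
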